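{- Let $P \subseteq \mathbb{R}^p$ be a $0/1$-polytope with $\dim(P) \geq 1$ and let $v \in \{0,1\}^p \setminus P$. Then $\operatorname{xc}^*\big(\operatorname{conv}(P \cup \{v\})\big) \leq \operatorname{xc}^*(P) + 1$.
   Context: A $0/1$-polytope is a polytope all of whose vertices lie in $\{0,1\}^p$. For a polytope $P \subseteq \mathbb{R}^p$, an extension of $P$ is a pair $(Q,\pi)$ where $Q \subseteq \mathbb{R}^q$ is a polyhedron and $\pi\colon \mathbb{R}^q \to \mathbb{R}^p$ is a linear map with $\pi(Q)=P$; its size is the number of facets of $Q$. An extension $(Q,\pi)$ of a $0/1$-polytope $P$ is a nice $0/1$-extension if (i) $Q$ is a $0/1$-polytope, (ii) each vertex of $Q$ is mapped by $\pi$ onto a vertex of $P$, and (iii) for each vertex $v$ of $P$ there is exactly one vertex of $Q$ mapped onto $v$. $\operatorname{xc}^*(P)$ is the smallest size of any nice $0/1$-extension of $P$.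
   Formalization: Coordinates, convex weights, the linear map π of each extension and the inequalities defining facets are taken over ℚ rather than ℝ. -}

module Defs where

open import Data.Nat using (ℕ; zero; suc)
open import Data.Fin using (Fin; zero; suc)
open import Data.Bool using (Bool; true; false)
open import Data.List using (List; length; lookup)
open import Data.Rational using (ℚ; 0ℚ; 1ℚ; _+_; _*_; _-_; _≤_; _<_)
open import Data.Product using (Σ; _×_; _,_)
open import Data.Sum using (_⊎_)
open import Relation.Binary.PropositionalEquality using (_≡_; _≢_)
open import Relation.Nullary using (¬_)

Vecℚ : ℕ → Set
Vecℚ n = Fin n → ℚ

_≈_ : ∀ {n} → Vecℚ n → Vecℚ n → Set
x ≈ y = ∀ i → x i ≡ y i

sumFin : ∀ {n} → (Fin n → ℚ) → ℚ
sumFin {zero} f = 0ℚ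
sumFin {suc n} f = f zero + sumFin (λ i → f (suc i))

dot : ∀ {n} → Vecℚ n → Vecℚ n → ℚ
dot a x = sumFin (λ i → a i * x i)

toℚ : Bool → ℚ
toℚ true = 1ℚ
toℚ false = 0ℚ

embed : ∀ {n} → (Fin n → Bool) → Vecℚ n
embed c i = toℚ (c i)

-- A finite set of 0/1 points; a 0/1-polytope is conv of such a set.
Pts : ℕ → Set
Pts n = List (Fin n → Bool)

_∈conv_ : ∀ {n} → Vecℚ n → Pts n → Set
x ∈conv S =
  Σ (Fin (length S) → ℚ) λ w →
    (∀ k → 0ℚ ≤ w k) × (sumFin w ≡ 1ℚ) ×
    (∀ i → sumFin (λ k → w k * embed (lookup S k) i) ≡ x i)

IsVertex : ∀ {n} → Pts n → Vecℚ n → Set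
IsVertex S x =
  x ∈conv S ×
  (∀ y z t → y ∈conv S → z ∈conv S → 0ℚ < t → t < 1ℚ →
     (∀ i → x i ≡ t * y i + (1ℚ - t) * z i) → y ≈ z)

-- dim(conv S) ≥ 1 : the polytope contains two distinct points
DimAtLeast1 : ∀ {n} → Pts n → Set
DimAtLeast1 S = Σ _ λ x → Σ _ λ y → x ∈conv S × y ∈conv S × ¬ (x ≈ y)

Mat : ℕ → ℕ → Set
Mat p q = Fin p → Fin q → ℚ

apply : ∀ {p q} → Mat p q → Vecℚ q → Vecℚ p
apply π x i = sumFin (λ j → π i j * x j)

IsNiceExt : ∀ {p q} → Pts p → Pts q → Mat p q → Set
IsNiceExt {p} {q} SP SQ π =
  -- π(Q) = P
  (∀ (y : Vecℚ p) → y ∈conv SP → Σ (Vecℚ q) λ x → x ∈conv SQ × apply π x ≈ y) ×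
  (∀ (x : Vecℚ q) → x ∈conv SQ → apply π x ∈conv SP) ×
  (∀ (x : Vecℚ q) → IsVertex SQ x → IsVertex SP (apply π x)) ×
  (∀ (y : Vecℚ p) → IsVertex SP y →
     Σ (Vecℚ q) λ x → IsVertex SQ x × apply π x ≈ y ×
       (∀ x′ → IsVertex SQ x′ → apply π x′ ≈ y → x′ ≈ x))

-- faces of conv S given by valid inequalities a·x ≤ b
Valid : ∀ {n} → Pts n → Vecℚ n → ℚ → Set
Valid S a b = ∀ x → x ∈conv S → dot a x ≤ b

InFace : ∀ {n} → Pts n → Vecℚ n → ℚ → Vecℚ n → Set
InFace S a b x = x ∈conv S × dot a x ≡ b

SameFace : ∀ {n} → Pts n → (Vecℚ n × ℚ) → (Vecℚ n × ℚ) → Set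
SameFace S (a , b) (a′ , b′) =
  ∀ x → (InFace S a b x → InFace S a′ b′ x) × (InFace S a′ b′ x → InFace S a b x)

-- facet = inclusion-maximal proper face
IsFacet : ∀ {n} → Pts n → (Vecℚ n × ℚ) → Set
IsFacet S (a , b) =
  Valid S a b ×
  (Σ _ λ x → x ∈conv S × ¬ (dot a x ≡ b)) ×
  (∀ a′ b′ → Valid S a′ b′ → (∀ x → InFace S a b x → InFace S a′ b′ x) →
     SameFace S (a , b) (a′ , b′) ⊎ (∀ x → x ∈conv S → dot a′ x ≡ b′))

HasFacets : ∀ {n} → Pts n → ℕ → Set
HasFacets {n} S k =
  Σ (Fin k → Vecℚ n × ℚ) λ F →
    (∀ i → IsFacet S (F i)) ×
    (∀ i j → i ≢ j → ¬ SameFace S (F i) (F j)) ×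
    (∀ f → IsFacet S f → Σ (Fin k) λ i → SameFace S f (F i))

HasNiceExtOfSize : ∀ {p} → Pts p → ℕ → Set
HasNiceExtOfSize {p} SP k =
  Σ ℕ λ q → Σ (Pts q) λ SQ → Σ (Mat p q) λ π → IsNiceExt SP SQ π × HasFacets SQ k

IsXcStar : ∀ {p} → Pts p → ℕ → Set
IsXcStar SP n = HasNiceExtOfSize SP n × (∀ k → HasNiceExtOfSize SP k → n Data.Nat.≤ k)
  where import Data.Nat

-- Let (Q , π) be a nice 0/1-extension of P = conv S of size n, Q = conv SQ ⊆ ℚ^q.
-- Build the pyramid Q′ = conv ({e₀} ∪ {(0 , c) : c ∈ SQ}) ⊆ ℚ^(1+q) over Q with
-- apex e₀, and the map π′ (x₀ , x) = x₀ · v + π x.  Every point of Q′ is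
-- s · e₀ + (1 - s) · (0 , z) with s ∈ [0,1] and z ∈ Q, which π′ sends to
-- s · v + (1 - s) · π z; hence π′ Q′ = conv (P ∪ {v}).  The vertices of Q′ are the
-- apex (sent to v) and the lifted vertices of Q (sent to vertices of P), and since
-- v ∉ P these fibres never collide, so (Q′ , π′) is again nice.  The facets of Q′
-- are the base x₀ ≥ 0 and the lifts b · x₀ + a · x ≤ b of the facets a · x ≤ b of
-- Q, so Q′ has n + 1 facets, and minimality of xc* gives m ≤ n + 1.
module Submission where

open import Defs
open import Data.Nat using (ℕ; zero; suc)
import Data.Nat as ℕ
import Data.Nat.Properties as ℕₚ
open import Data.Fin using (Fin; zero; suc)
open import Data.Bool using (Bool; true; false)
open import Data.List using ([]; _∷_; length; lookup; map)
open import Data.List.Relation.Unary.Any using (Any; here; there)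
open import Data.List.Relation.Unary.Any.Properties using (map⁻)
open import Data.Rational
  using (ℚ; 0ℚ; 1ℚ; _+_; _*_; _-_; -_; _≤_; _<_; 1/_; NonZero; ≢-nonZero; nonNegative; positive)
open import Data.Rational.Properties
open import Data.Rational.Solver using (module +-*-Solver)
open import Data.Product using (Σ; _×_; _,_; proj₁; proj₂)
open import Data.Sum using (_⊎_; inj₁; inj₂)
open import Data.Empty using (⊥-elim)
open import Relation.Binary.PropositionalEquality
open import Relation.Binary.Definitions using (tri<; tri≈; tri>)
open import Relation.Nullary using (¬_; yes; no)

open +-*-Solver using (solve; _:+_; _:*_; _:-_; _:=_; con)

0≤1 : 0ℚ ≤ 1ℚ
0≤1 = nonNegative⁻¹ 1ℚ

0≢1 : ¬ (0ℚ ≡ 1ℚ)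
0≢1 e = 1≢0 (sym e)

-1≢0 : ¬ (- 1ℚ ≡ 0ℚ)
-1≢0 e = 1≢0 (neg-injective e)

neg-0 : - 0ℚ ≡ 0ℚ
neg-0 = refl

nonNeg-* : ∀ {a b} → 0ℚ ≤ a → 0ℚ ≤ b → 0ℚ ≤ a * b
nonNeg-* {a} {b} pa pb =
  nonNegative⁻¹ _ {{nonNeg*nonNeg⇒nonNeg a {{nonNegative pa}} b {{nonNegative pb}}}}

nonNeg-+ : ∀ {a b} → 0ℚ ≤ a → 0ℚ ≤ b → 0ℚ ≤ a + b
nonNeg-+ {a} {b} pa pb = subst (_≤ a + b) (+-identityˡ 0ℚ) (+-mono-≤ pa pb)

≤⇒0≤- : ∀ {a b} → a ≤ b → 0ℚ ≤ b - a
≤⇒0≤- {a} {b} p = subst (_≤ b - a) (+-inverseʳ a) (+-monoˡ-≤ (- a) p)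

0≤-⇒≤ : ∀ {a b} → 0ℚ ≤ b - a → a ≤ b
0≤-⇒≤ {a} {b} p = subst₂ _≤_ (+-identityˡ a) b-a+a≡b (+-monoˡ-≤ a p)
  where
  b-a+a≡b : (b - a) + a ≡ b
  b-a+a≡b = solve 2 (λ a b → (b :- a) :+ a := b) refl a b

0<1- : ∀ {t} → t < 1ℚ → 0ℚ < 1ℚ - t
0<1- {t} p = subst (_< 1ℚ - t) (+-inverseʳ t) (+-monoˡ-< (- t) p)

nonNeg-+≡0ˡ : ∀ {a b} → 0ℚ ≤ a → 0ℚ ≤ b → a + b ≡ 0ℚ → a ≡ 0ℚ
nonNeg-+≡0ˡ {a} {b} pa pb e =
  ≤-antisym (subst₂ _≤_ (+-identityʳ a) e (+-monoʳ-≤ a pb)) pa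

nonNeg-+≡0ʳ : ∀ {a b} → 0ℚ ≤ a → 0ℚ ≤ b → a + b ≡ 0ℚ → b ≡ 0ℚ
nonNeg-+≡0ʳ {a} {b} pa pb e = nonNeg-+≡0ˡ pb pa (trans (+-comm b a) e)

*≡0 : ∀ a b → a * b ≡ 0ℚ → a ≡ 0ℚ ⊎ b ≡ 0ℚ
*≡0 a b e with a ≟ 0ℚ
... | yes a≡0 = inj₁ a≡0
... | no a≢0 = inj₂ (begin
    b                ≡⟨ sym (*-identityˡ b) ⟩
    1ℚ * b           ≡⟨ cong (_* b) (sym (*-inverseˡ a {{≢-nonZero a≢0}})) ⟩
    (a⁻¹ * a) * b    ≡⟨ *-assoc a⁻¹ a b ⟩
    a⁻¹ * (a * b)    ≡⟨ cong (a⁻¹ *_) e ⟩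
    a⁻¹ * 0ℚ         ≡⟨ *-zeroʳ a⁻¹ ⟩
    0ℚ               ∎)
  where
  open ≡-Reasoning
  a⁻¹ : ℚ
  a⁻¹ = (1/ a) {{≢-nonZero a≢0}}

≤⇒≡⊎< : ∀ {a b} → a ≤ b → a ≡ b ⊎ a < b
≤⇒≡⊎< {a} {b} p with <-cmp a b
... | tri< a<b _ _ = inj₂ a<b
... | tri≈ _ a≡b _ = inj₁ a≡b
... | tri> _ _ a>b = ⊥-elim (<-irrefl refl (≤-<-trans p a>b))

-≡0⇒≡ : ∀ a b → a - b ≡ 0ℚ → a ≡ b
-≡0⇒≡ a b p = begin
  a                ≡⟨ solve 2 (λ a b → a := (a :- b) :+ b) refl a b ⟩
  (a - b) + b      ≡⟨ cong (_+ b) p ⟩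
  0ℚ + b           ≡⟨ +-identityˡ b ⟩
  b                ∎
  where open ≡-Reasoning

sumFin-cong : ∀ {n} {f g : Fin n → ℚ} → (∀ i → f i ≡ g i) → sumFin f ≡ sumFin g
sumFin-cong {zero} e = refl
sumFin-cong {suc n} e = cong₂ _+_ (e zero) (sumFin-cong (λ i → e (suc i)))

sumFin-* : ∀ {n} c (f : Fin n → ℚ) → sumFin (λ i → c * f i) ≡ c * sumFin f
sumFin-* {zero} c f = sym (*-zeroʳ c)
sumFin-* {suc n} c f =
  trans (cong (c * f zero +_) (sumFin-* c (λ i → f (suc i))))
        (sym (*-distribˡ-+ c (f zero) _))

sumFin-0 : ∀ {n} → sumFin {n} (λ _ → 0ℚ) ≡ 0ℚ
sumFin-0 {zero} = refl
sumFin-0 {suc n} = trans (cong (0ℚ +_) (sumFin-0 {n})) (+-identityˡ 0ℚ)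

sumFin-nonNeg : ∀ {n} (f : Fin n → ℚ) → (∀ i → 0ℚ ≤ f i) → 0ℚ ≤ sumFin f
sumFin-nonNeg {zero} f p = ≤-refl
sumFin-nonNeg {suc n} f p =
  nonNeg-+ (p zero) (sumFin-nonNeg (λ i → f (suc i)) (λ i → p (suc i)))

sumFin-nonNeg≡0 : ∀ {n} (f : Fin n → ℚ) → (∀ i → 0ℚ ≤ f i) → sumFin f ≡ 0ℚ →
                  ∀ i → f i ≡ 0ℚ
sumFin-nonNeg≡0 {suc n} f p e zero =
  nonNeg-+≡0ˡ (p zero) (sumFin-nonNeg _ (λ i → p (suc i))) e
sumFin-nonNeg≡0 {suc n} f p e (suc i) =
  sumFin-nonNeg≡0 (λ i → f (suc i)) (λ i → p (suc i))
    (nonNeg-+≡0ʳ (p zero) (sumFin-nonNeg _ (λ i → p (suc i))) e) i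

dot-cong : ∀ {n} (a : Vecℚ n) {x y : Vecℚ n} → x ≈ y → dot a x ≡ dot a y
dot-cong a e = sumFin-cong (λ i → cong (a i *_) (e i))

dot-* : ∀ {n} (a : Vecℚ n) c (x : Vecℚ n) → dot a (λ i → c * x i) ≡ c * dot a x
dot-* a c x =
  trans (sumFin-cong (λ i → solve 3 (λ a c x → a :* (c :* x) := c :* (a :* x)) refl (a i) c (x i)))
        (sumFin-* c (λ i → a i * x i))

dot-0ʳ : ∀ {n} (a : Vecℚ n) → dot a (λ _ → 0ℚ) ≡ 0ℚ
dot-0ʳ {n} a = trans (sumFin-cong (λ i → *-zeroʳ (a i))) (sumFin-0 {n})

dot-0ˡ : ∀ {n} (x : Vecℚ n) → dot (λ _ → 0ℚ) x ≡ 0ℚ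
dot-0ˡ {n} x = trans (sumFin-cong (λ i → *-zeroˡ (x i))) (sumFin-0 {n})

-- Convex hulls of lists of 0/1 points

≈-sym : ∀ {n} {x y : Vecℚ n} → x ≈ y → y ≈ x
≈-sym e i = sym (e i)

≈-trans : ∀ {n} {x y z : Vecℚ n} → x ≈ y → y ≈ z → x ≈ z
≈-trans e f i = trans (e i) (f i)

Weights : ∀ {n} (S : Pts n) → (Fin (length S) → ℚ) → Vecℚ n → Set
Weights S w x = (∀ k → 0ℚ ≤ w k) × (sumFin w ≡ 1ℚ) ×
  (∀ i → sumFin (λ k → w k * embed (lookup S k) i) ≡ x i)

conv-resp : ∀ {n} {S : Pts n} {x y} → x ∈conv S → x ≈ y → y ∈conv S
conv-resp (w , w≥0 , Σw≡1 , x≡) e = w , w≥0 , Σw≡1 , (λ i → trans (x≡ i) (e i))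

conv-[] : ∀ {n} {x : Vecℚ n} → ¬ (x ∈conv [])
conv-[] (_ , _ , Σw≡1 , _) = 0≢1 Σw≡1

generator∈conv : ∀ {n} (u : Fin n → Bool) (S : Pts n) → embed u ∈conv (u ∷ S)
generator∈conv u S = w , w≥0 , Σw≡1 , x≡
  where
  w : Fin (suc (length S)) → ℚ
  w zero = 1ℚ
  w (suc k) = 0ℚ
  w≥0 : ∀ k → 0ℚ ≤ w k
  w≥0 zero = 0≤1
  w≥0 (suc k) = ≤-refl
  Σw≡1 : sumFin w ≡ 1ℚ
  Σw≡1 = trans (cong (1ℚ +_) (sumFin-0 {length S})) (+-identityʳ 1ℚ)
  x≡ : ∀ i → sumFin (λ k → w k * embed (lookup (u ∷ S) k) i) ≡ embed u i
  x≡ i = trans (cong₂ _+_ (*-identityˡ (embed u i))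
                  (trans (sumFin-cong (λ k → *-zeroˡ (embed (lookup S k) i))) (sumFin-0 {length S})))
               (+-identityʳ (embed u i))

conv-∷ : ∀ {n} (u : Fin n → Bool) (S : Pts n) t y x → 0ℚ ≤ t → t ≤ 1ℚ → y ∈conv S →
         (∀ i → x i ≡ t * embed u i + (1ℚ - t) * y i) → x ∈conv (u ∷ S)
conv-∷ u S t y x t≥0 t≤1 (w , w≥0 , Σw≡1 , y≡) x≡ = w′ , w′≥0 , Σw′≡1 , x≡′
  where
  w′ : Fin (suc (length S)) → ℚ
  w′ zero = t
  w′ (suc k) = (1ℚ - t) * w k
  w′≥0 : ∀ k → 0ℚ ≤ w′ k
  w′≥0 zero = t≥0
  w′≥0 (suc k) = nonNeg-* (≤⇒0≤- t≤1) (w≥0 k)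
  Σw′≡1 : sumFin w′ ≡ 1ℚ
  Σw′≡1 = trans (cong (t +_) (trans (sumFin-* (1ℚ - t) w) (cong ((1ℚ - t) *_) Σw≡1)))
                (solve 1 (λ t → t :+ (con 1ℚ :- t) :* con 1ℚ := con 1ℚ) refl t)
  x≡′ : ∀ i → sumFin (λ k → w′ k * embed (lookup (u ∷ S) k) i) ≡ x i
  x≡′ i = trans (cong (t * embed u i +_)
                  (trans (sumFin-cong (λ k → *-assoc (1ℚ - t) (w k) (embed (lookup S k) i)))
                    (trans (sumFin-* (1ℚ - t) (λ k → w k * embed (lookup S k) i))
                      (cong ((1ℚ - t) *_) (y≡ i)))))
                (sym (x≡ i))

conv-weaken : ∀ {n} (u : Fin n → Bool) (S : Pts n) {y} → y ∈conv S → y ∈conv (u ∷ S)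
conv-weaken u S {y} y∈S = conv-∷ u S 0ℚ y y ≤-refl 0≤1 y∈S
  (λ i → solve 2 (λ e y → y := con 0ℚ :* e :+ (con 1ℚ :- con 0ℚ) :* y) refl (embed u i) (y i))

Segment : ∀ {n} → (Fin n → Bool) → Pts n → Vecℚ n → Set
Segment {n} u S x = Σ ℚ λ t → Σ (Vecℚ n) λ y → 0ℚ ≤ t × t < 1ℚ × y ∈conv S ×
  (∀ i → x i ≡ t * embed u i + (1ℚ - t) * y i)

restWeight : ∀ {n} (S : Pts n) → (Fin (suc (length S)) → ℚ) → ℚ
restWeight S w = sumFin (λ k → w (suc k))

no-rest⇒u : ∀ {n} (u : Fin n → Bool) (S : Pts n) x w → Weights (u ∷ S) w x →
            restWeight S w ≡ 0ℚ → x ≈ embed u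
no-rest⇒u u S x w (w≥0 , Σw≡1 , x≡) rest≡0 i = begin
  x i ≡⟨ sym (x≡ i) ⟩
  w zero * embed u i + sumFin (λ k → w (suc k) * embed (lookup S k) i)
    ≡⟨ cong₂ (λ a b → a * embed u i + b) w₀≡1
        (trans (sumFin-cong (λ k → trans (cong (_* embed (lookup S k) i) (wₖ≡0 k))
                                          (*-zeroˡ (embed (lookup S k) i))))
               (sumFin-0 {length S})) ⟩
  1ℚ * embed u i + 0ℚ ≡⟨ trans (+-identityʳ _) (*-identityˡ _) ⟩
  embed u i ∎
  where
  open ≡-Reasoning
  wₖ≡0 : ∀ k → w (suc k) ≡ 0ℚ
  wₖ≡0 = sumFin-nonNeg≡0 (λ k → w (suc k)) (λ k → w≥0 (suc k)) rest≡0
  w₀≡1 : w zero ≡ 1ℚ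
  w₀≡1 = trans (sym (+-identityʳ (w zero))) (trans (cong (w zero +_) (sym rest≡0)) Σw≡1)

-- If some weight R is left for S, rescaling it by 1/R gives a point y of conv S
-- with x = w₀ · u + (1 - w₀) · y.
rest⇒segment : ∀ {n} (u : Fin n → Bool) (S : Pts n) x w → Weights (u ∷ S) w x →
               0ℚ < restWeight S w → Segment u S x
rest⇒segment {n} u S x w (w≥0 , Σw≡1 , x≡) R>0 = w zero , y , w≥0 zero , w₀<1 , y∈S , x≡segment
  where
  open ≡-Reasoning
  R : ℚ
  R = restWeight S w
  instance
    R≢0 : NonZero R
    R≢0 = ≢-nonZero (λ e → <-irrefl (sym e) R>0)
  R⁻¹ : ℚ
  R⁻¹ = 1/ R
  y : Vecℚ n
  y i = sumFin (λ k → (R⁻¹ * w (suc k)) * embed (lookup S k) i)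
  R⁻¹≥0 : 0ℚ ≤ R⁻¹
  R⁻¹≥0 = nonNegative⁻¹ R⁻¹ {{pos⇒nonNeg R⁻¹ {{1/pos⇒pos R {{positive R>0}}}}}}
  y∈S : y ∈conv S
  y∈S = (λ k → R⁻¹ * w (suc k)) , (λ k → nonNeg-* R⁻¹≥0 (w≥0 (suc k))) ,
        trans (sumFin-* R⁻¹ (λ k → w (suc k))) (*-inverseˡ R) , (λ i → refl)
  R≡1-w₀ : R ≡ 1ℚ - w zero
  R≡1-w₀ = trans (solve 2 (λ r w → r := (w :+ r) :- w) refl R (w zero)) (cong (_- w zero) Σw≡1)
  w₀<1 : w zero < 1ℚ
  w₀<1 = subst₂ _<_ (+-identityʳ (w zero)) Σw≡1 (+-monoʳ-< (w zero) R>0)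
  Ry≡ : ∀ i → R * y i ≡ sumFin (λ k → w (suc k) * embed (lookup S k) i)
  Ry≡ i = begin
    R * y i
      ≡⟨ cong (R *_) (trans (sumFin-cong (λ k → *-assoc R⁻¹ (w (suc k)) (embed (lookup S k) i)))
                            (sumFin-* R⁻¹ G)) ⟩
    R * (R⁻¹ * sumFin G) ≡⟨ sym (*-assoc R R⁻¹ _) ⟩
    (R * R⁻¹) * sumFin G ≡⟨ cong (_* sumFin G) (*-inverseʳ R) ⟩
    1ℚ * sumFin G        ≡⟨ *-identityˡ _ ⟩
    sumFin G             ∎
    where
    G : Fin (length S) → ℚ
    G k = w (suc k) * embed (lookup S k) i
  x≡segment : ∀ i → x i ≡ w zero * embed u i + (1ℚ - w zero) * y i
  x≡segment i = trans (sym (x≡ i))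
    (cong (w zero * embed u i +_) (trans (sym (Ry≡ i)) (cong (_* y i) R≡1-w₀)))

conv-∷-split : ∀ {n} (u : Fin n → Bool) (S : Pts n) x → x ∈conv (u ∷ S) →
               x ≈ embed u ⊎ Segment u S x
conv-∷-split u S x (w , weights)
  with ≤⇒≡⊎< (sumFin-nonNeg (λ k → w (suc k)) (λ k → proj₁ weights (suc k)))
... | inj₁ 0≡rest = inj₁ (no-rest⇒u u S x w weights (sym 0≡rest))
... | inj₂ rest>0 = inj₂ (rest⇒segment u S x w weights rest>0)

-- Vertices of 0/1-polytopes

InUnit : ℚ → Set
InUnit a = 0ℚ ≤ a × a ≤ 1ℚ

toℚ-InUnit : ∀ b → InUnit (toℚ b)
toℚ-InUnit true = 0≤1 , ≤-refl
toℚ-InUnit false = ≤-refl , 0≤1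

segment-InUnit : ∀ {t a b} → 0ℚ ≤ t → t ≤ 1ℚ → InUnit a → InUnit b →
                 InUnit (t * a + (1ℚ - t) * b)
segment-InUnit {t} {a} {b} t≥0 t≤1 (a≥0 , a≤1) (b≥0 , b≤1) =
  nonNeg-+ (nonNeg-* t≥0 a≥0) (nonNeg-* (≤⇒0≤- t≤1) b≥0) ,
  0≤-⇒≤ (subst (0ℚ ≤_) complement
    (nonNeg-+ (nonNeg-* t≥0 (≤⇒0≤- a≤1)) (nonNeg-* (≤⇒0≤- t≤1) (≤⇒0≤- b≤1))))
  where
  complement : t * (1ℚ - a) + (1ℚ - t) * (1ℚ - b) ≡ 1ℚ - (t * a + (1ℚ - t) * b)
  complement = solve 3 (λ t a b → t :* (con 1ℚ :- a) :+ (con 1ℚ :- t) :* (con 1ℚ :- b)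
                                  := con 1ℚ :- (t :* a :+ (con 1ℚ :- t) :* b)) refl t a b

conv⊆cube : ∀ {n} (S : Pts n) x → x ∈conv S → ∀ i → InUnit (x i)
conv⊆cube [] x x∈S i = ⊥-elim (conv-[] x∈S)
conv⊆cube (u ∷ S) x x∈S i with conv-∷-split u S x x∈S
... | inj₁ x≈u = subst InUnit (sym (x≈u i)) (toℚ-InUnit (u i))
... | inj₂ (t , y , t≥0 , t<1 , y∈S , x≡) =
  subst InUnit (sym (x≡ i))
    (segment-InUnit t≥0 (<⇒≤ t<1) (toℚ-InUnit (u i)) (conv⊆cube S y y∈S i))

0-extreme : ∀ {a b t} → 0ℚ ≤ a → 0ℚ ≤ b → 0ℚ < t → t < 1ℚ →
            t * a + (1ℚ - t) * b ≡ 0ℚ → a ≡ b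
0-extreme {a} {b} {t} a≥0 b≥0 t>0 t<1 e = trans (a≡0 (*≡0 t a ta≡0)) (sym (b≡0 (*≡0 (1ℚ - t) b tb≡0)))
  where
  ta≥0 = nonNeg-* (<⇒≤ t>0) a≥0
  tb≥0 = nonNeg-* (≤⇒0≤- (<⇒≤ t<1)) b≥0
  ta≡0 = nonNeg-+≡0ˡ ta≥0 tb≥0 e
  tb≡0 = nonNeg-+≡0ʳ ta≥0 tb≥0 e
  a≡0 : t ≡ 0ℚ ⊎ a ≡ 0ℚ → a ≡ 0ℚ
  a≡0 (inj₁ t≡0) = ⊥-elim (<-irrefl (sym t≡0) t>0)
  a≡0 (inj₂ a≡0) = a≡0
  b≡0 : 1ℚ - t ≡ 0ℚ ⊎ b ≡ 0ℚ → b ≡ 0ℚ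
  b≡0 (inj₁ 1-t≡0) = ⊥-elim (<-irrefl (sym 1-t≡0) (0<1- t<1))
  b≡0 (inj₂ b≡0) = b≡0

-- The case of 1 reduces to that of 0 under a ↦ 1 - a.
1-extreme : ∀ {a b t} → a ≤ 1ℚ → b ≤ 1ℚ → 0ℚ < t → t < 1ℚ →
            t * a + (1ℚ - t) * b ≡ 1ℚ → a ≡ b
1-extreme {a} {b} {t} a≤1 b≤1 t>0 t<1 e = begin
  a               ≡⟨ solve 1 (λ a → a := con 1ℚ :- (con 1ℚ :- a)) refl a ⟩
  1ℚ - (1ℚ - a)   ≡⟨ cong (λ a → 1ℚ - a) flipped ⟩
  1ℚ - (1ℚ - b)   ≡⟨ solve 1 (λ b → con 1ℚ :- (con 1ℚ :- b) := b) refl b ⟩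
  b               ∎
  where
  open ≡-Reasoning
  flipped : 1ℚ - a ≡ 1ℚ - b
  flipped = 0-extreme (≤⇒0≤- a≤1) (≤⇒0≤- b≤1) t>0 t<1
    (trans (solve 3 (λ t a b → t :* (con 1ℚ :- a) :+ (con 1ℚ :- t) :* (con 1ℚ :- b)
                             := con 1ℚ :- (t :* a :+ (con 1ℚ :- t) :* b)) refl t a b)
           (trans (cong (λ a → 1ℚ - a) e) (+-inverseʳ 1ℚ)))

bit-extreme : ∀ c {a b t} → InUnit a → InUnit b → 0ℚ < t → t < 1ℚ →
              toℚ c ≡ t * a + (1ℚ - t) * b → a ≡ b
bit-extreme true (_ , a≤1) (_ , b≤1) t>0 t<1 e = 1-extreme a≤1 b≤1 t>0 t<1 (sym e)
bit-extreme false (a≥0 , _) (b≥0 , _) t>0 t<1 e = 0-extreme a≥0 b≥0 t>0 t<1 (sym e)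

Extreme : ∀ {n} → Pts n → Vecℚ n → Set
Extreme S x = ∀ y z t → y ∈conv S → z ∈conv S → 0ℚ < t → t < 1ℚ →
  (∀ i → x i ≡ t * y i + (1ℚ - t) * z i) → y ≈ z

0/1-point-vertex : ∀ {n} (S : Pts n) c → embed c ∈conv S → IsVertex S (embed c)
0/1-point-vertex S c c∈S = c∈S , λ y z t y∈S z∈S t>0 t<1 e i →
  bit-extreme (c i) (conv⊆cube S y y∈S i) (conv⊆cube S z z∈S i) t>0 t<1 (e i)

vertex-resp : ∀ {n} {S : Pts n} {x y} → IsVertex S x → x ≈ y → IsVertex S y
vertex-resp {S = S} (x∈S , x-ext) e =
  conv-resp {S = S} x∈S e ,
  λ y′ z′ t y′∈S z′∈S t>0 t<1 y≡ → x-ext y′ z′ t y′∈S z′∈S t>0 t<1 (λ i → trans (e i) (y≡ i))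

-- Every vertex of conv S is one of the generators: a point strictly inside a
-- segment from u to conv S is not extreme.
vertex-generator : ∀ {n} (S : Pts n) x → x ∈conv S → Extreme S x → Any (λ c → x ≈ embed c) S
vertex-generator [] x x∈S x-ext = ⊥-elim (conv-[] x∈S)
vertex-generator (u ∷ S) x x∈S x-ext with conv-∷-split u S x x∈S
... | inj₁ x≈u = here x≈u
... | inj₂ (t , y , t≥0 , t<1 , y∈S , x≡) with ≤⇒≡⊎< t≥0
...   | inj₁ 0≡t = there (vertex-generator S x (conv-resp {S = S} y∈S (≈-sym x≈y)) x-ext′)
  where
  x≈y : x ≈ y
  x≈y i = trans (x≡ i) (trans (cong (λ t → t * embed u i + (1ℚ - t) * y i) (sym 0≡t))
            (solve 2 (λ e y → con 0ℚ :* e :+ (con 1ℚ :- con 0ℚ) :* y := y) refl (embed u i) (y i)))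
  x-ext′ : Extreme S x
  x-ext′ y′ z′ t′ y′∈S z′∈S = x-ext y′ z′ t′ (conv-weaken u S y′∈S) (conv-weaken u S z′∈S)
...   | inj₂ t>0 = here λ i → begin
    x i                                      ≡⟨ x≡ i ⟩
    t * embed u i + (1ℚ - t) * y i
      ≡⟨ cong (λ a → t * embed u i + (1ℚ - t) * a) (sym (u≈y i)) ⟩
    t * embed u i + (1ℚ - t) * embed u i
      ≡⟨ solve 2 (λ t e → t :* e :+ (con 1ℚ :- t) :* e := e) refl t (embed u i) ⟩
    embed u i                                ∎
  where
  open ≡-Reasoning
  u≈y : embed u ≈ y
  u≈y = x-ext (embed u) y t (generator∈conv u S) (conv-weaken u S y∈S) t>0 t<1 x≡

generator-witness : ∀ {n} {P : (Fin n → Bool) → Set} (S : Pts n) → Any P S →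
                    Σ (Fin n → Bool) λ c → embed c ∈conv S × P c
generator-witness (u ∷ S) (here Pu) = u , generator∈conv u S , Pu
generator-witness (u ∷ S) (there P∈S) with generator-witness S P∈S
... | c , c∈S , Pc = c , conv-weaken u S c∈S , Pc

vertex-0/1 : ∀ {n} (S : Pts n) x → IsVertex S x →
             Σ (Fin n → Bool) λ c → embed c ∈conv S × x ≈ embed c
vertex-0/1 S x (x∈S , x-ext) = generator-witness S (vertex-generator S x x∈S x-ext)

cons : ∀ {q} → ℚ → Vecℚ q → Vecℚ (suc q)
cons a x zero = a
cons a x (suc i) = x i

tail : ∀ {q} → Vecℚ (suc q) → Vecℚ q
tail x i = x (suc i)

lift : ∀ {q} → (Fin q → Bool) → (Fin (suc q) → Bool)
lift c zero = false
lift c (suc i) = c i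

apex : ∀ {q} → Fin (suc q) → Bool
apex zero = true
apex (suc i) = false

embed-lift : ∀ {q} (c : Fin q → Bool) → embed (lift c) ≈ cons 0ℚ (embed c)
embed-lift c zero = refl
embed-lift c (suc i) = refl

cons-cong : ∀ {q} {x y : Vecℚ q} → x ≈ y → cons 0ℚ x ≈ cons 0ℚ y
cons-cong e zero = refl
cons-cong e (suc i) = e i

conv-lift⁻ : ∀ {q} (S : Pts q) x → x ∈conv (map lift S) → x zero ≡ 0ℚ × tail x ∈conv S
conv-lift⁻ [] x x∈ = ⊥-elim (conv-[] x∈)
conv-lift⁻ (c ∷ S) x x∈ with conv-∷-split (lift c) (map lift S) x x∈
... | inj₁ x≈c = x≈c zero , conv-resp {S = c ∷ S} (generator∈conv c S) (λ i → sym (x≈c (suc i)))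
... | inj₂ (t , y , t≥0 , t<1 , y∈ , x≡) with conv-lift⁻ S y y∈
...   | y₀≡0 , tail-y∈S =
  trans (x≡ zero) (trans (cong (λ a → t * 0ℚ + (1ℚ - t) * a) y₀≡0)
    (solve 1 (λ t → t :* con 0ℚ :+ (con 1ℚ :- t) :* con 0ℚ := con 0ℚ) refl t)) ,
  conv-∷ c S t (tail y) (tail x) t≥0 (<⇒≤ t<1) tail-y∈S (λ i → x≡ (suc i))

conv-lift⁺ : ∀ {q} (S : Pts q) x → x zero ≡ 0ℚ → tail x ∈conv S → x ∈conv (map lift S)
conv-lift⁺ [] x x₀≡0 x∈ = ⊥-elim (conv-[] x∈)
conv-lift⁺ (c ∷ S) x x₀≡0 x∈ with conv-∷-split c S (tail x) x∈
... | inj₁ x≈c = conv-resp {S = lift c ∷ map lift S} (generator∈conv (lift c) (map lift S)) c≈x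
  where
  c≈x : embed (lift c) ≈ x
  c≈x zero = sym x₀≡0
  c≈x (suc i) = sym (x≈c i)
... | inj₂ (t , y , t≥0 , t<1 , y∈S , x≡) =
  conv-∷ (lift c) (map lift S) t (cons 0ℚ y) x t≥0 (<⇒≤ t<1)
    (conv-lift⁺ S (cons 0ℚ y) refl y∈S) x≡′
  where
  x≡′ : ∀ i → x i ≡ t * embed (lift c) i + (1ℚ - t) * cons 0ℚ y i
  x≡′ zero = trans x₀≡0
    (solve 1 (λ t → con 0ℚ := t :* con 0ℚ :+ (con 1ℚ :- t) :* con 0ℚ) refl t)
  x≡′ (suc i) = x≡ i

FaceIncl : ∀ {n} → Pts n → Vecℚ n → ℚ → Vecℚ n → ℚ → Set
FaceIncl S a b a′ b′ = ∀ x → InFace S a b x → InFace S a′ b′ x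

Tight : ∀ {n} → Pts n → Vecℚ n → ℚ → Set
Tight S a b = ∀ x → x ∈conv S → dot a x ≡ b

-- A linear form c on the pyramid takes the value c₀ · s + (1 - s) · A at the
-- point with coordinates (s , z), where A is the value of its tail at z.

constant-segment : ∀ d s → d * s + (1ℚ - s) * d ≡ d
constant-segment d s = solve 2 (λ d s → d :* s :+ (con 1ℚ :- s) :* d := d) refl d s

-- If the value d is attained with apex value d, then s = 1 or A = d; either way a
-- second form with apex value f whose tail takes f whenever the first tail takes d
-- also attains f.
tight-transfer : ∀ d f s A B → d * s + (1ℚ - s) * A ≡ d → (A ≡ d → B ≡ f) →
                 f * s + (1ℚ - s) * B ≡ f
tight-transfer d f s A B tight A≡d⇒B≡f = cases (*≡0 (1ℚ - s) (A - d) factored)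
  where
  factored : (1ℚ - s) * (A - d) ≡ 0ℚ
  factored = trans
    (solve 3 (λ s d A → (con 1ℚ :- s) :* (A :- d) := (d :* s :+ (con 1ℚ :- s) :* A) :- d) refl s d A)
    (trans (cong (_- d) tight) (+-inverseʳ d))
  cases : 1ℚ - s ≡ 0ℚ ⊎ A - d ≡ 0ℚ → f * s + (1ℚ - s) * B ≡ f
  cases (inj₁ 1-s≡0) = begin
    f * s + (1ℚ - s) * B    ≡⟨ cong (λ a → f * s + a * B) 1-s≡0 ⟩
    f * s + 0ℚ * B          ≡⟨ cong (λ a → f * a + 0ℚ * B) (sym (-≡0⇒≡ 1ℚ s 1-s≡0)) ⟩
    f * 1ℚ + 0ℚ * B         ≡⟨ solve 2 (λ f B → f :* con 1ℚ :+ con 0ℚ :* B := f) refl f B ⟩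
    f                       ∎
    where open ≡-Reasoning
  cases (inj₂ A-d≡0) = trans (cong (λ a → f * s + (1ℚ - s) * a) (A≡d⇒B≡f (-≡0⇒≡ A d A-d≡0)))
                             (constant-segment f s)

below-apex : ∀ β d s A → 0ℚ ≤ s → s ≤ 1ℚ → A ≤ d → β < d → β * s + (1ℚ - s) * A ≡ d → s ≡ 0ℚ
below-apex β d s A s≥0 s≤1 A≤d β<d tight = cases (*≡0 s (d - β) slack≡0)
  where
  slack≡0 : s * (d - β) ≡ 0ℚ
  slack≡0 = nonNeg-+≡0ˡ (nonNeg-* s≥0 (≤⇒0≤- (<⇒≤ β<d))) (nonNeg-* (≤⇒0≤- s≤1) (≤⇒0≤- A≤d))
    (trans (solve 4 (λ s β d A → s :* (d :- β) :+ (con 1ℚ :- s) :* (d :- A)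
                                 := d :- (β :* s :+ (con 1ℚ :- s) :* A)) refl s β d A)
           (trans (cong (λ a → d - a) tight) (+-inverseʳ d)))
  cases : s ≡ 0ℚ ⊎ d - β ≡ 0ℚ → s ≡ 0ℚ
  cases (inj₁ s≡0) = s≡0
  cases (inj₂ d-β≡0) = ⊥-elim (<-irrefl (sym (-≡0⇒≡ d β d-β≡0)) β<d)

-- The pyramid over a non-empty 0/1-polytope

module Pyramid {q : ℕ} (SQ : Pts q) (z₀ : Vecℚ q) (z₀∈Q : z₀ ∈conv SQ) where

  SQ′ : Pts (suc q)
  SQ′ = apex ∷ map lift SQ

  Coords : Vecℚ (suc q) → Set
  Coords x′ = Σ ℚ λ s → Σ (Vecℚ q) λ z → 0ℚ ≤ s × s ≤ 1ℚ × z ∈conv SQ ×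
    x′ zero ≡ s × (∀ i → x′ (suc i) ≡ (1ℚ - s) * z i)

  -- Every point of Q′ has pyramid coordinates; the apex uses the point z₀ of Q.
  coords : ∀ x′ → x′ ∈conv SQ′ → Coords x′
  coords x′ x′∈ with conv-∷-split apex (map lift SQ) x′ x′∈
  ... | inj₁ x′≈apex = 1ℚ , z₀ , 0≤1 , ≤-refl , z₀∈Q , x′≈apex zero ,
        (λ i → trans (x′≈apex (suc i))
                 (solve 1 (λ z → con 0ℚ := (con 1ℚ :- con 1ℚ) :* z) refl (z₀ i)))
  ... | inj₂ (t , y , t≥0 , t<1 , y∈ , x′≡) with conv-lift⁻ SQ y y∈
  ...   | y₀≡0 , tail-y∈Q = t , tail y , t≥0 , <⇒≤ t<1 , tail-y∈Q ,
          trans (x′≡ zero) (trans (cong (λ a → t * 1ℚ + (1ℚ - t) * a) y₀≡0)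
            (solve 1 (λ t → t :* con 1ℚ :+ (con 1ℚ :- t) :* con 0ℚ := t) refl t)) ,
          (λ i → trans (x′≡ (suc i))
            (solve 2 (λ t y → t :* con 0ℚ :+ (con 1ℚ :- t) :* y := (con 1ℚ :- t) :* y) refl t (y (suc i))))

  fromCoords : ∀ x′ s z → 0ℚ ≤ s → s ≤ 1ℚ → z ∈conv SQ → x′ zero ≡ s →
               (∀ i → x′ (suc i) ≡ (1ℚ - s) * z i) → x′ ∈conv SQ′
  fromCoords x′ s z s≥0 s≤1 z∈Q x′₀≡ x′≡ =
    conv-∷ apex (map lift SQ) s (cons 0ℚ z) x′ s≥0 s≤1 (conv-lift⁺ SQ (cons 0ℚ z) refl z∈Q) x′≡′
    where
    x′≡′ : ∀ i → x′ i ≡ s * embed apex i + (1ℚ - s) * cons 0ℚ z i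
    x′≡′ zero = trans x′₀≡ (solve 1 (λ s → s := s :* con 1ℚ :+ (con 1ℚ :- s) :* con 0ℚ) refl s)
    x′≡′ (suc i) = trans (x′≡ i)
      (solve 2 (λ s z → (con 1ℚ :- s) :* z := s :* con 0ℚ :+ (con 1ℚ :- s) :* z) refl s (z i))

  dot-coords : ∀ (c x′ : Vecℚ (suc q)) s z → x′ zero ≡ s → (∀ i → x′ (suc i) ≡ (1ℚ - s) * z i) →
               dot c x′ ≡ c zero * s + (1ℚ - s) * dot (tail c) z
  dot-coords c x′ s z x′₀≡ x′≡ =
    cong₂ _+_ (cong (c zero *_) x′₀≡) (trans (dot-cong (tail c) x′≡) (dot-* (tail c) (1ℚ - s) z))

  base∈ : ∀ z → z ∈conv SQ → cons 0ℚ z ∈conv SQ′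
  base∈ z z∈Q = fromCoords (cons 0ℚ z) 0ℚ z ≤-refl 0≤1 z∈Q refl
    (λ i → solve 1 (λ z → z := (con 1ℚ :- con 0ℚ) :* z) refl (z i))

  dot-base : ∀ (c : Vecℚ (suc q)) z → dot c (cons 0ℚ z) ≡ dot (tail c) z
  dot-base c z = trans (cong (_+ dot (tail c) z) (*-zeroʳ (c zero))) (+-identityˡ _)

  apex∈ : embed apex ∈conv SQ′
  apex∈ = generator∈conv apex (map lift SQ)

  dot-apex : ∀ (c : Vecℚ (suc q)) → dot c (embed apex) ≡ c zero
  dot-apex c = trans (cong₂ _+_ (*-identityʳ (c zero)) (dot-0ʳ (tail c))) (+-identityʳ _)

  -- Lifting and restricting inequalities.  An inequality c · x′ ≤ d on Q′ with
  -- apex value c₀ = d is the lift of the inequality tail c · z ≤ d on Q.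

  lifted-value : ∀ (c x′ : Vecℚ (suc q)) d s z → c zero ≡ d → x′ zero ≡ s →
                 (∀ i → x′ (suc i) ≡ (1ℚ - s) * z i) →
                 dot c x′ ≡ d * s + (1ℚ - s) * dot (tail c) z
  lifted-value c x′ d s z c₀≡d x′₀≡ x′≡ =
    trans (dot-coords c x′ s z x′₀≡ x′≡) (cong (λ a → a * s + (1ℚ - s) * dot (tail c) z) c₀≡d)

  lift-valid : ∀ (c : Vecℚ (suc q)) d → c zero ≡ d → Valid SQ (tail c) d → Valid SQ′ c d
  lift-valid c d c₀≡d valid x′ x′∈ with coords x′ x′∈
  ... | s , z , s≥0 , s≤1 , z∈Q , x′₀≡ , x′≡ =
    subst (_≤ d) (sym (lifted-value c x′ d s z c₀≡d x′₀≡ x′≡))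
      (0≤-⇒≤ (subst (0ℚ ≤_) slack (nonNeg-* (≤⇒0≤- s≤1) (≤⇒0≤- (valid z z∈Q)))))
    where
    slack : (1ℚ - s) * (d - dot (tail c) z) ≡ d - (d * s + (1ℚ - s) * dot (tail c) z)
    slack = solve 3 (λ s d A → (con 1ℚ :- s) :* (d :- A) := d :- (d :* s :+ (con 1ℚ :- s) :* A))
                    refl s d (dot (tail c) z)

  lift-tight : ∀ (c : Vecℚ (suc q)) d → c zero ≡ d → Tight SQ (tail c) d → Tight SQ′ c d
  lift-tight c d c₀≡d tight x′ x′∈ with coords x′ x′∈
  ... | s , z , _ , _ , z∈Q , x′₀≡ , x′≡ =
    trans (lifted-value c x′ d s z c₀≡d x′₀≡ x′≡)
      (trans (cong (λ a → d * s + (1ℚ - s) * a) (tight z z∈Q)) (constant-segment d s))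

  lift-face⊆ : ∀ (c e : Vecℚ (suc q)) d f → c zero ≡ d → e zero ≡ f →
               (∀ z → z ∈conv SQ → dot (tail c) z ≡ d → dot (tail e) z ≡ f) →
               FaceIncl SQ′ c d e f
  lift-face⊆ c e d f c₀≡d e₀≡f tail⊆ x′ (x′∈ , tight) with coords x′ x′∈
  ... | s , z , _ , _ , z∈Q , x′₀≡ , x′≡ =
    x′∈ ,
    trans (lifted-value e x′ f s z e₀≡f x′₀≡ x′≡)
      (tight-transfer d f s (dot (tail c) z) (dot (tail e) z)
        (trans (sym (lifted-value c x′ d s z c₀≡d x′₀≡ x′≡)) tight) (tail⊆ z z∈Q))

  restrict-valid : ∀ (c : Vecℚ (suc q)) d → Valid SQ′ c d → Valid SQ (tail c) d
  restrict-valid c d valid z z∈Q = subst (_≤ d) (dot-base c z) (valid (cons 0ℚ z) (base∈ z z∈Q))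

  restrict-tight : ∀ (c : Vecℚ (suc q)) d → Tight SQ′ c d → Tight SQ (tail c) d
  restrict-tight c d tight z z∈Q = trans (sym (dot-base c z)) (tight (cons 0ℚ z) (base∈ z z∈Q))

  restrict-face⊆ : ∀ (c e : Vecℚ (suc q)) d f → FaceIncl SQ′ c d e f →
                   FaceIncl SQ (tail c) d (tail e) f
  restrict-face⊆ c e d f c⊆e z (z∈Q , tight) =
    z∈Q , trans (sym (dot-base e z)) (proj₂ (c⊆e (cons 0ℚ z) (base∈ z z∈Q , trans (dot-base c z) tight)))

  restrict-same : ∀ (c e : Vecℚ (suc q)) d f → SameFace SQ′ (c , d) (e , f) →
                  SameFace SQ (tail c , d) (tail e , f)
  restrict-same c e d f same z =
    restrict-face⊆ c e d f (λ x′ → proj₁ (same x′)) z ,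
    restrict-face⊆ e c f d (λ x′ → proj₂ (same x′)) z

-- The facets of the pyramid: the base and the lifted facets of Q

module PyramidFacets {q : ℕ} (SQ : Pts q) (z₀ : Vecℚ q) (z₀∈Q : z₀ ∈conv SQ)
                     (n : ℕ) (facetsQ : HasFacets SQ n) where
  open Pyramid SQ z₀ z₀∈Q

  F : Fin n → Vecℚ q × ℚ
  F = proj₁ facetsQ

  F-facet : ∀ i → IsFacet SQ (F i)
  F-facet = proj₁ (proj₂ facetsQ)

  F-distinct : ∀ i j → i ≢ j → ¬ SameFace SQ (F i) (F j)
  F-distinct = proj₁ (proj₂ (proj₂ facetsQ))

  F-complete : ∀ f → IsFacet SQ f → Σ (Fin n) λ i → SameFace SQ f (F i)
  F-complete = proj₂ (proj₂ (proj₂ facetsQ))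

  baseForm : Vecℚ (suc q)
  baseForm = cons (- 1ℚ) (λ _ → 0ℚ)

  dot-baseForm : ∀ x′ → dot baseForm x′ ≡ - (x′ zero)
  dot-baseForm x′ = begin
    - 1ℚ * x′ zero + dot (λ _ → 0ℚ) (tail x′) ≡⟨ cong (- 1ℚ * x′ zero +_) (dot-0ˡ (tail x′)) ⟩
    - 1ℚ * x′ zero + 0ℚ                       ≡⟨ +-identityʳ _ ⟩
    - 1ℚ * x′ zero                            ≡⟨ sym (neg-distribˡ-* 1ℚ (x′ zero)) ⟩
    - (1ℚ * x′ zero)                          ≡⟨ cong -_ (*-identityˡ (x′ zero)) ⟩
    - (x′ zero)                               ∎
    where open ≡-Reasoning

  base-on-base : ∀ z → dot baseForm (cons 0ℚ z) ≡ 0ℚ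
  base-on-base z = trans (dot-baseForm (cons 0ℚ z)) neg-0

  base-off-apex : ¬ (dot baseForm (embed apex) ≡ 0ℚ)
  base-off-apex e = -1≢0 (trans (sym (dot-apex baseForm)) e)

  liftIneq : Vecℚ q × ℚ → Vecℚ (suc q) × ℚ
  liftIneq (a , b) = cons b a , b

  below-apex⊆base : ∀ c d → Valid SQ′ c d → c zero < d → FaceIncl SQ′ c d baseForm 0ℚ
  below-apex⊆base c d valid c₀<d x′ (x′∈ , tight) with coords x′ x′∈
  ... | s , z , s≥0 , s≤1 , z∈Q , x′₀≡ , x′≡ =
    x′∈ , trans (dot-baseForm x′) (trans (cong -_ (trans x′₀≡ s≡0)) neg-0)
    where
    s≡0 : s ≡ 0ℚ
    s≡0 = below-apex (c zero) d s (dot (tail c) z) s≥0 s≤1 (restrict-valid c d valid z z∈Q) c₀<d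
            (trans (sym (dot-coords c x′ s z x′₀≡ x′≡)) tight)

  base-facet : IsFacet SQ′ (baseForm , 0ℚ)
  base-facet = valid , (embed apex , apex∈ , base-off-apex) , maximal
    where
    valid : Valid SQ′ baseForm 0ℚ
    valid x′ x′∈ with coords x′ x′∈
    ... | s , _ , s≥0 , _ , _ , x′₀≡ , _ =
      subst₂ _≤_ (sym (trans (dot-baseForm x′) (cong -_ x′₀≡))) neg-0 (neg-antimono-≤ s≥0)
    maximal : ∀ c d → Valid SQ′ c d → FaceIncl SQ′ baseForm 0ℚ c d →
              SameFace SQ′ (baseForm , 0ℚ) (c , d) ⊎ Tight SQ′ c d
    maximal c d valid base⊆c = cases (≤⇒≡⊎< (subst (_≤ d) (dot-apex c) (valid (embed apex) apex∈)))
      where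
      tail-tight : Tight SQ (tail c) d
      tail-tight z z∈Q =
        trans (sym (dot-base c z)) (proj₂ (base⊆c (cons 0ℚ z) (base∈ z z∈Q , base-on-base z)))
      cases : c zero ≡ d ⊎ c zero < d → SameFace SQ′ (baseForm , 0ℚ) (c , d) ⊎ Tight SQ′ c d
      cases (inj₁ c₀≡d) = inj₂ (lift-tight c d c₀≡d tail-tight)
      cases (inj₂ c₀<d) = inj₁ λ x′ → base⊆c x′ , below-apex⊆base c d valid c₀<d x′

  lift-facet : ∀ a b → IsFacet SQ (a , b) → IsFacet SQ′ (liftIneq (a , b))
  lift-facet a b (valid , (x , x∈Q , x-off) , maximalQ) =
    lift-valid (cons b a) b refl valid ,
    (cons 0ℚ x , base∈ x x∈Q , (λ e → x-off (trans (sym (dot-base (cons b a) x)) e))) ,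
    maximal
    where
    maximal : ∀ c d → Valid SQ′ c d → FaceIncl SQ′ (cons b a) b c d →
              SameFace SQ′ (cons b a , b) (c , d) ⊎ Tight SQ′ c d
    maximal c d validc lift⊆c = cases (maximalQ (tail c) d (restrict-valid c d validc)
                                          (restrict-face⊆ (cons b a) c b d lift⊆c))
      where
      -- The apex lies on the lifted facet, hence on the face of c.
      c₀≡d : c zero ≡ d
      c₀≡d = trans (sym (dot-apex c)) (proj₂ (lift⊆c (embed apex) (apex∈ , dot-apex (cons b a))))
      cases : SameFace SQ (a , b) (tail c , d) ⊎ Tight SQ (tail c) d →
              SameFace SQ′ (cons b a , b) (c , d) ⊎ Tight SQ′ c d
      cases (inj₁ same) = inj₁ λ x′ →
        lift⊆c x′ ,
        lift-face⊆ c (cons b a) d b c₀≡d refl (λ z z∈Q e → proj₂ (proj₂ (same z) (z∈Q , e))) x′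
      cases (inj₂ tight) = inj₂ (lift-tight c d c₀≡d tight)

  restrict-facet : ∀ c d → IsFacet SQ′ (c , d) → c zero ≡ d → IsFacet SQ (tail c , d)
  restrict-facet c d (valid , (x′ , x′∈ , x′-off) , maximal′) c₀≡d =
    restrict-valid c d valid , witness (coords x′ x′∈) , maximal
    where
    witness : Coords x′ → Σ _ λ z → z ∈conv SQ × ¬ (dot (tail c) z ≡ d)
    witness (s , z , _ , _ , z∈Q , x′₀≡ , x′≡) = z , z∈Q , λ tight → x′-off
      (trans (lifted-value c x′ d s z c₀≡d x′₀≡ x′≡)
        (trans (cong (λ a → d * s + (1ℚ - s) * a) tight) (constant-segment d s)))
    maximal : ∀ a b → Valid SQ a b → FaceIncl SQ (tail c) d a b →
              SameFace SQ (tail c , d) (a , b) ⊎ Tight SQ a b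
    maximal a b validQ tail⊆a = cases (maximal′ (cons b a) b (lift-valid (cons b a) b refl validQ)
      (lift-face⊆ c (cons b a) d b c₀≡d refl (λ z z∈Q e → proj₂ (tail⊆a z (z∈Q , e)))))
      where
      cases : SameFace SQ′ (c , d) (cons b a , b) ⊎ Tight SQ′ (cons b a) b →
              SameFace SQ (tail c , d) (a , b) ⊎ Tight SQ a b
      cases (inj₁ same) = inj₁ (restrict-same c (cons b a) d b same)
      cases (inj₂ tight) = inj₂ (restrict-tight (cons b a) b tight)

  F′ : Fin (suc n) → Vecℚ (suc q) × ℚ
  F′ zero = baseForm , 0ℚ
  F′ (suc i) = liftIneq (F i)

  F′-facet : ∀ i → IsFacet SQ′ (F′ i)
  F′-facet zero = base-facet
  F′-facet (suc i) = lift-facet (proj₁ (F i)) (proj₂ (F i)) (F-facet i)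

  base⊈lift : ∀ j → ¬ FaceIncl SQ′ baseForm 0ℚ (proj₁ (liftIneq (F j))) (proj₂ (F j))
  base⊈lift j base⊆lift with proj₁ (proj₂ (F-facet j))
  ... | x , x∈Q , x-off =
    x-off (trans (sym (dot-base (proj₁ (liftIneq (F j))) x))
                 (proj₂ (base⊆lift (cons 0ℚ x) (base∈ x x∈Q , base-on-base x))))

  F′-distinct : ∀ i j → i ≢ j → ¬ SameFace SQ′ (F′ i) (F′ j)
  F′-distinct zero zero i≢j _ = i≢j refl
  F′-distinct zero (suc j) _ same = base⊈lift j (λ x′ → proj₁ (same x′))
  F′-distinct (suc i) zero _ same = base⊈lift i (λ x′ → proj₂ (same x′))
  F′-distinct (suc i) (suc j) i≢j same =
    F-distinct i j (λ i≡j → i≢j (cong suc i≡j))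
      (restrict-same (proj₁ (liftIneq (F i))) (proj₁ (liftIneq (F j))) (proj₂ (F i)) (proj₂ (F j)) same)

  -- Every facet of Q′ is the base (apex value below the right-hand side) or a
  -- lifted facet of Q (apex on the facet).
  F′-complete : ∀ f → IsFacet SQ′ f → Σ (Fin (suc n)) λ i → SameFace SQ′ f (F′ i)
  F′-complete (c , d) facet =
    cases (≤⇒≡⊎< (subst (_≤ d) (dot-apex c) (proj₁ facet (embed apex) apex∈)))
    where
    through-apex : c zero ≡ d → Σ (Fin n) (λ i → SameFace SQ (tail c , d) (F i)) →
                   Σ (Fin (suc n)) λ i → SameFace SQ′ (c , d) (F′ i)
    through-apex c₀≡d (i , same) = suc i , λ x′ →
      lift-face⊆ c (proj₁ (liftIneq (F i))) d (proj₂ (F i)) c₀≡d refl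
        (λ z z∈Q e → proj₂ (proj₁ (same z) (z∈Q , e))) x′ ,
      lift-face⊆ (proj₁ (liftIneq (F i))) c (proj₂ (F i)) d refl c₀≡d
        (λ z z∈Q e → proj₂ (proj₂ (same z) (z∈Q , e))) x′
    is-base : SameFace SQ′ (c , d) (baseForm , 0ℚ) ⊎ Tight SQ′ baseForm 0ℚ →
              Σ (Fin (suc n)) λ i → SameFace SQ′ (c , d) (F′ i)
    is-base (inj₁ same) = zero , same
    is-base (inj₂ tight) = ⊥-elim (base-off-apex (tight (embed apex) apex∈))
    cases : c zero ≡ d ⊎ c zero < d → Σ (Fin (suc n)) λ i → SameFace SQ′ (c , d) (F′ i)
    cases (inj₁ c₀≡d) = through-apex c₀≡d (F-complete (tail c , d) (restrict-facet c d facet c₀≡d))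
    cases (inj₂ c₀<d) = is-base (proj₂ (proj₂ facet) baseForm 0ℚ (proj₁ base-facet)
                                   (below-apex⊆base c d (proj₁ facet) c₀<d))

  pyramid-facets : HasFacets SQ′ (suc n)
  pyramid-facets = F′ , F′-facet , F′-distinct , F′-complete

-- The pyramid is a nice 0/1-extension of conv (P ∪ {v})

module PyramidExtension {p : ℕ} (S : Pts p) (v : Fin p → Bool) (v∉P : ¬ (embed v ∈conv S))
                        {q : ℕ} (SQ : Pts q) (π : Mat p q) (nice : IsNiceExt S SQ π)
                        (z₀ : Vecℚ q) (z₀∈Q : z₀ ∈conv SQ) where
  open Pyramid SQ z₀ z₀∈Q

  π′ : Mat p (suc q)
  π′ i = cons (toℚ (v i)) (π i)

  π-onto : ∀ y → y ∈conv S → Σ (Vecℚ q) λ x → x ∈conv SQ × apply π x ≈ y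
  π-onto = proj₁ nice

  π-into : ∀ x → x ∈conv SQ → apply π x ∈conv S
  π-into = proj₁ (proj₂ nice)

  π-vertex : ∀ x → IsVertex SQ x → IsVertex S (apply π x)
  π-vertex = proj₁ (proj₂ (proj₂ nice))

  π-fibre : ∀ y → IsVertex S y → Σ (Vecℚ q) λ x → IsVertex SQ x × apply π x ≈ y ×
              (∀ x′ → IsVertex SQ x′ → apply π x′ ≈ y → x′ ≈ x)
  π-fibre = proj₂ (proj₂ (proj₂ nice))

  π′-apex : ∀ x′ → x′ ≈ embed apex → apply π′ x′ ≈ embed v
  π′-apex x′ e i = trans (dot-cong (π′ i) e) (dot-apex (π′ i))

  π′-base : ∀ x′ z → x′ ≈ cons 0ℚ z → apply π′ x′ ≈ apply π z
  π′-base x′ z e i = trans (dot-cong (π′ i) e) (dot-base (π′ i) z)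

  π′-coords : ∀ x′ s z → x′ zero ≡ s → (∀ i → x′ (suc i) ≡ (1ℚ - s) * z i) →
              ∀ i → apply π′ x′ i ≡ s * embed v i + (1ℚ - s) * apply π z i
  π′-coords x′ s z x′₀≡ x′≡ i =
    trans (dot-coords (π′ i) x′ s z x′₀≡ x′≡)
          (cong (_+ (1ℚ - s) * apply π z i) (*-comm (toℚ (v i)) s))

  data PyramidVertex (x′ : Vecℚ (suc q)) : Set where
    is-apex : x′ ≈ embed apex → PyramidVertex x′
    is-lift : ∀ c → embed c ∈conv SQ → x′ ≈ cons 0ℚ (embed c) → PyramidVertex x′

  pyramid-vertex : ∀ x′ → IsVertex SQ′ x′ → PyramidVertex x′
  pyramid-vertex x′ (x′∈ , x′-ext) with vertex-generator SQ′ x′ x′∈ x′-ext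
  ... | here x′≈apex = is-apex x′≈apex
  ... | there x′∈lifts with generator-witness {P = λ c → x′ ≈ embed (lift c)} SQ (map⁻ x′∈lifts)
  ...   | c , c∈Q , x′≈c = is-lift c c∈Q (≈-trans x′≈c (embed-lift c))

  onto : ∀ y → y ∈conv (v ∷ S) → Σ (Vecℚ (suc q)) λ x′ → x′ ∈conv SQ′ × apply π′ x′ ≈ y
  onto y y∈ with conv-∷-split v S y y∈
  ... | inj₁ y≈v = embed apex , apex∈ , ≈-trans (π′-apex (embed apex) (λ i → refl)) (≈-sym y≈v)
  ... | inj₂ (t , y₁ , t≥0 , t<1 , y₁∈P , y≡) with π-onto y₁ y₁∈P
  ...   | x , x∈Q , πx≈y₁ =
    x′ , fromCoords x′ t x t≥0 (<⇒≤ t<1) x∈Q refl (λ i → refl) ,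
    λ i → trans (π′-coords x′ t x refl (λ j → refl) i)
                (trans (cong (λ a → t * embed v i + (1ℚ - t) * a) (πx≈y₁ i)) (sym (y≡ i)))
    where
    x′ : Vecℚ (suc q)
    x′ = cons t (λ j → (1ℚ - t) * x j)

  into : ∀ x′ → x′ ∈conv SQ′ → apply π′ x′ ∈conv (v ∷ S)
  into x′ x′∈ with coords x′ x′∈
  ... | s , z , s≥0 , s≤1 , z∈Q , x′₀≡ , x′≡ =
    conv-∷ v S s (apply π z) (apply π′ x′) s≥0 s≤1 (π-into z z∈Q) (π′-coords x′ s z x′₀≡ x′≡)

  vertex↦vertex : ∀ x′ → IsVertex SQ′ x′ → IsVertex (v ∷ S) (apply π′ x′)
  vertex↦vertex x′ x′-vertex with pyramid-vertex x′ x′-vertex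
  ... | is-apex x′≈apex =
    vertex-resp {S = v ∷ S} (0/1-point-vertex (v ∷ S) v (generator∈conv v S))
      (≈-sym (π′-apex x′ x′≈apex))
  ... | is-lift c c∈Q x′≈c
    with vertex-0/1 S (apply π (embed c)) (π-vertex (embed c) (0/1-point-vertex SQ c c∈Q))
  ...   | u , u∈P , πc≈u =
    vertex-resp {S = v ∷ S} (0/1-point-vertex (v ∷ S) u (conv-weaken v S u∈P))
      (≈-sym (≈-trans (π′-base x′ (embed c) x′≈c) πc≈u))

  UniqueFibre : Vecℚ p → Set
  UniqueFibre y = Σ (Vecℚ (suc q)) λ x′ → IsVertex SQ′ x′ × apply π′ x′ ≈ y ×
    (∀ x″ → IsVertex SQ′ x″ → apply π′ x″ ≈ y → x″ ≈ x′)

  -- Only the apex lies over v, since lifted vertices map into P ∌ v.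
  fibre-v : ∀ y → y ≈ embed v → UniqueFibre y
  fibre-v y y≈v =
    embed apex , 0/1-point-vertex SQ′ apex apex∈ ,
    ≈-trans (π′-apex (embed apex) (λ i → refl)) (≈-sym y≈v) , unique
    where
    unique : ∀ x″ → IsVertex SQ′ x″ → apply π′ x″ ≈ y → x″ ≈ embed apex
    unique x″ x″-vertex π′x″≈y with pyramid-vertex x″ x″-vertex
    ... | is-apex x″≈apex = x″≈apex
    ... | is-lift c c∈Q x″≈c = ⊥-elim (v∉P (conv-resp {S = S} (π-into (embed c) c∈Q)
            (≈-trans (≈-sym (π′-base x″ (embed c) x″≈c)) (≈-trans π′x″≈y y≈v))))

  fibre-P : ∀ y u → embed u ∈conv S → y ≈ embed u → UniqueFibre y
  fibre-P y u u∈P y≈u with π-fibre (embed u) (0/1-point-vertex S u u∈P)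
  ... | x , x-vertex , πx≈u , x-unique with vertex-0/1 SQ x x-vertex
  ...   | c , c∈Q , x≈c =
    cons 0ℚ x , lift-vertex , ≈-trans (π′-base (cons 0ℚ x) x (λ i → refl)) (≈-trans πx≈u (≈-sym y≈u)) ,
    unique
    where
    lift-vertex : IsVertex SQ′ (cons 0ℚ x)
    lift-vertex = vertex-resp {S = SQ′}
      (0/1-point-vertex SQ′ (lift c) (conv-resp {S = SQ′} (base∈ (embed c) c∈Q) (≈-sym (embed-lift c))))
      (≈-trans (embed-lift c) (cons-cong (≈-sym x≈c)))
    unique : ∀ x″ → IsVertex SQ′ x″ → apply π′ x″ ≈ y → x″ ≈ cons 0ℚ x
    unique x″ x″-vertex π′x″≈y with pyramid-vertex x″ x″-vertex
    ... | is-apex x″≈apex = ⊥-elim (v∉P (conv-resp {S = S} u∈P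
            (≈-trans (≈-sym y≈u) (≈-trans (≈-sym π′x″≈y) (π′-apex x″ x″≈apex)))))
    ... | is-lift c′ c′∈Q x″≈c′ =
      ≈-trans x″≈c′ (cons-cong (x-unique (embed c′) (0/1-point-vertex SQ c′ c′∈Q)
        (≈-trans (≈-sym (π′-base x″ (embed c′) x″≈c′)) (≈-trans π′x″≈y y≈u))))

  fibre : ∀ y → IsVertex (v ∷ S) y → UniqueFibre y
  fibre y (y∈ , y-ext) with vertex-generator (v ∷ S) y y∈ y-ext
  ... | here y≈v = fibre-v y y≈v
  ... | there y∈P with generator-witness {P = λ c → y ≈ embed c} S y∈P
  ...   | u , u∈P , y≈u = fibre-P y u u∈P y≈u

  pyramid-nice : IsNiceExt (v ∷ S) SQ′ π′
  pyramid-nice = onto , into , vertex↦vertex , fibre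

corollary2p7 : (p : ℕ) (S : Pts p) → DimAtLeast1 S →
    (v : Fin p → Bool) → ¬ (embed v ∈conv S) →
    (n m : ℕ) → IsXcStar S n → IsXcStar (v ∷ S) m → m ℕ.≤ n ℕ.+ 1
corollary2p7 p S (y , _ , y∈P , _) v v∉P n m ((q , SQ , π , nice , facetsQ) , _) (_ , m-minimal) =
  subst (m ℕ.≤_) (ℕₚ.+-comm 1 n) (m-minimal (suc n) extension)
  where
  -- P is non-empty, hence so is Q = π⁻¹ P.
  z₀ : Vecℚ q
  z₀ = proj₁ (proj₁ nice y y∈P)
  z₀∈Q : z₀ ∈conv SQ
  z₀∈Q = proj₁ (proj₂ (proj₁ nice y y∈P))
  extension : HasNiceExtOfSize (v ∷ S) (suc n)
  extension = suc q , Pyramid.SQ′ SQ z₀ z₀∈Q , PyramidExtension.π′ S v v∉P SQ π nice z₀ z₀∈Q ,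
              PyramidExtension.pyramid-nice S v v∉P SQ π nice z₀ z₀∈Q ,
              PyramidFacets.pyramid-facets SQ z₀ z₀∈Q n facetsQ
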